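{- Let $0<m<n$ and let $w\in A_{(n-m,m)}$ be such that for every $i\in\mathbb Z/n\mathbb Z$ the generator $s_i$ occurs exactly once in a reduced word of $w$. Then $w$ is an $n$-connected ribbon.
   Context: $\widetilde S_n$ is the affine symmetric group with generators $s_i$, $i\in\mathbb Z/n\mathbb Z$, relations $s_i^2=1$, $s_is_{i+1}s_i=s_{i+1}s_is_{i+1}$, $s_is_j=s_js_i$ for $i-j\ne\pm1$; $\ell$ is the length. For $J\subsetneq\mathbb Z/n\mathbb Z$, $d_J$ (resp. $u_J$) is the product of the $s_j$, $j\in J$, each exactly once, with $s_{j+1}$ to the left of $s_j$ (resp. $s_j$ to the left of $s_{j+1}$) whenever $j,j+1\in J$. $w$ is 321-avoiding if no reduced word of $w$ contains a consecutive factor $s_is_{i+1}s_i$. $\mathrm{maxr}(w)$ (resp. $\mathrm{maxc}(w)$) is the largest $|J|$ such that $w=vd_J$ (resp. $w=vu_J$) with $\ell(w)=\ell(v)+|J|$. $A_{(n-m,m)}$ is the set of 321-avoiding $w$ with $\mathrm{maxc}(w)\le m$ and $\mathrm{maxr}(w)\le n-m$. An $n$-connected ribbon is an element of the form $u_{J^c}d_J$ with $\emptyset\ne J\subsetneq\mathbb Z/n\mathbb Z$, $J^c$ the complement of $J$. -}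

module Defs where

open import Data.Nat using (ℕ; zero; suc; _+_; _∸_; _<_; _≤_)
open import Data.Nat.Properties using () renaming (_≟_ to _≟ℕ_)
open import Data.Fin using (Fin; zero; suc; toℕ; lower₁; _≟_)
open import Data.Fin.Subset using (Subset; _∈_; _∉_; ∁; ∣_∣)
open import Data.List using (List; []; _∷_; _++_; length; filter)
open import Data.List.Relation.Unary.Unique.Propositional using (Unique)
open import Data.List.Membership.Propositional using () renaming (_∈_ to _∈L_)
open import Data.Product using (Σ; ∃; ∃-syntax; _×_; _,_)
open import Data.Sum using (_⊎_)
open import Relation.Binary.PropositionalEquality using (_≡_; _≢_)
open import Relation.Binary.Construct.Closure.Equivalence using (EqClosure)
open import Relation.Nullary using (¬_; yes; no)
open import Function.Bundles using (_⇔_)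

-- Generators s_i of the affine symmetric group, i ∈ ℤ/nℤ, are Fin n.
-- next i = i + 1 (mod n)
next : ∀ {n} → Fin n → Fin n
next {suc k} i with k ≟ℕ toℕ i
... | yes _ = zero
... | no ne = suc (lower₁ i ne)

Adjacent : ∀ {n} → Fin n → Fin n → Set
Adjacent i j = (j ≡ next i) ⊎ (i ≡ next j)

-- Words in the generators (left-to-right = product left-to-right).
Word : ℕ → Set
Word n = List (Fin n)

-- The braid relation s_i s_{i+1} s_i = s_{i+1} s_i s_{i+1} is imposed when
-- i+2 ≢ i (i.e. n ≥ 3); for n = 2 (infinite dihedral group) it is absent,
-- per the standard Coxeter convention m(s_0,s_1) = ∞.
data Step {n : ℕ} : Word n → Word n → Set where
  square : ∀ (u v : Word n) (i : Fin n) →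
           Step (u ++ i ∷ i ∷ v) (u ++ v)
  braid  : ∀ (u v : Word n) (i : Fin n) → next (next i) ≢ i →
           Step (u ++ i ∷ next i ∷ i ∷ v) (u ++ next i ∷ i ∷ next i ∷ v)
  comm   : ∀ (u v : Word n) (i j : Fin n) → ¬ Adjacent i j →
           Step (u ++ i ∷ j ∷ v) (u ++ j ∷ i ∷ v)

_≈_ : ∀ {n} → Word n → Word n → Set
_≈_ = EqClosure Step

Reduced : ∀ {n} → Word n → Set
Reduced {n} x = ∀ (y : Word n) → y ≈ x → length x ≤ length y

HasLength : ∀ {n} → Word n → ℕ → Set
HasLength {n} w k = ∃[ x ] (x ≈ w × Reduced x × length x ≡ k)

Proper : ∀ {n} → Subset n → Set
Proper J = ∃[ j ] (j ∉ J)

IsD : ∀ {n} → Subset n → Word n → Set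
IsD {n} J x =
  Unique x × (∀ j → (j ∈ J) ⇔ (j ∈L x)) ×
  (∀ j → j ∈ J → next j ∈ J →
     ∃[ a ] ∃[ b ] (x ≡ a ++ next j ∷ b × j ∈L b))

IsU : ∀ {n} → Subset n → Word n → Set
IsU {n} J x =
  Unique x × (∀ j → (j ∈ J) ⇔ (j ∈L x)) ×
  (∀ j → j ∈ J → next j ∈ J →
     ∃[ a ] ∃[ b ] (x ≡ a ++ j ∷ b × next j ∈L b))

Avoids321 : ∀ {n} → Word n → Set
Avoids321 {n} w = ∀ (x : Word n) → x ≈ w → Reduced x →
  ∀ (a b : Word n) (i : Fin n) → x ≢ a ++ i ∷ next i ∷ i ∷ b

RightDescentD : ∀ {n} → Word n → Subset n → Set
RightDescentD {n} w J = Proper J × ∃[ v ] ∃[ d ] ∃[ k ]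
  (IsD J d × (v ++ d) ≈ w × HasLength v k × HasLength w (k + ∣ J ∣))

RightDescentU : ∀ {n} → Word n → Subset n → Set
RightDescentU {n} w J = Proper J × ∃[ v ] ∃[ u ] ∃[ k ]
  (IsU J u × (v ++ u) ≈ w × HasLength v k × HasLength w (k + ∣ J ∣))

IsMaxr : ∀ {n} → Word n → ℕ → Set
IsMaxr {n} w k = (∃[ J ] (RightDescentD w J × ∣ J ∣ ≡ k)) ×
  (∀ (J : Subset n) → RightDescentD w J → ∣ J ∣ ≤ k)

IsMaxc : ∀ {n} → Word n → ℕ → Set
IsMaxc {n} w k = (∃[ J ] (RightDescentU w J × ∣ J ∣ ≡ k)) ×
  (∀ (J : Subset n) → RightDescentU w J → ∣ J ∣ ≤ k)

InA : (n m : ℕ) → Word n → Set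
InA n m w = Avoids321 w ×
  (∃[ k ] (IsMaxc w k × k ≤ m)) × (∃[ k ] (IsMaxr w k × k ≤ n ∸ m))

occ : ∀ {n} → Fin n → Word n → ℕ
occ i x = length (filter (_≟ i) x)

EachGenOnce : ∀ {n} → Word n → Set
EachGenOnce {n} w = ∃[ x ] (x ≈ w × Reduced x × (∀ (i : Fin n) → occ i x ≡ 1))

ConnectedRibbon : ∀ {n} → Word n → Set
ConnectedRibbon {n} w = ∃[ J ] ((∃[ j ] (j ∈ J)) × Proper J ×
  ∃[ u ] ∃[ d ] (IsU (∁ J) u × IsD J d × w ≈ (u ++ d)))

module Submission where

-- A reduced word x of w using every generator s_i exactly once is a
-- permutation of the generators (a Coxeter word).  Such a word is always a
-- connected ribbon.
--
-- Let J be the set of i such that s_{i+1} occurs before s_i in x.  Then: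
--   * two letters a ∈ J, b ∉ J with a before b in x never satisfy
--     a - b = ±1, so bubbling the letters of J to the right uses only
--     commutations: x ≈ u ++ d, with u (resp. d) the subword of letters
--     outside (resp. inside) J;
--   * d is a word of d_J and u a word of u_{J^c}, since the relative order
--     of two letters is the same in x and in its subwords;
--   * the first letter of x lies outside J and the last one inside J, so J
--     is nonempty and proper.

open import Defs
open import Data.Nat using (ℕ; zero; suc; _<_; _≤_; z≤n; s≤s)
open import Data.Nat.Properties
  using (≤-trans; ≤-refl; ≤-reflexive; n≤1+n; 1+n≰n; 1+n≢0; 1+n≢n) renaming (_≟_ to _≟ℕ_)
open import Data.Fin using (Fin; zero; suc; toℕ; _≟_)
open import Data.Fin.Properties using (toℕ-lower₁)
open import Data.Fin.Subset using (Subset; ∁) renaming (_∈_ to _∈S_)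
open import Data.Fin.Subset.Properties using (_∈?_; x∈∁p⇒x∉p; x∉p⇒x∈∁p)
open import Data.Vec using (tabulate)
open import Data.Vec.Properties using (lookup∘tabulate; []=⇒lookup; lookup⇒[]=)
open import Data.List using (List; []; _∷_; _++_; filter; initLast; _∷ʳ′_)
open import Data.List.Relation.Unary.All as All using (All; []; _∷_)
open import Data.List.Relation.Unary.AllPairs using (AllPairs; []; _∷_)
open import Data.List.Relation.Unary.Any using (here; there; any?)
open import Data.List.Relation.Unary.Unique.Propositional using (Unique)
open import Data.List.Relation.Unary.Unique.Propositional.Properties using (filter⁺)
open import Data.List.Membership.Propositional using () renaming (_∈_ to _∈L_)
open import Data.List.Membership.Propositional.Properties using (∈-++⁺ʳ; ∈-++⁻; ∈-filter⁺; ∈-filter⁻)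
open import Data.Product using (∃-syntax; _×_; _,_; proj₂)
open import Data.Sum using (_⊎_; inj₁; inj₂) renaming (map to ⊎-map)
open import Function using (_∘_)
open import Function.Bundles using (_⇔_; mk⇔; module Equivalence)
open import Level using (Level)
open import Relation.Binary.PropositionalEquality using (_≡_; _≢_; refl; sym; trans; cong)
open import Relation.Binary.Construct.Closure.Equivalence using (gmap; symmetric)
open import Relation.Binary.Construct.Closure.ReflexiveTransitive using (ε; _◅_; _◅◅_)
open import Relation.Binary.Construct.Closure.Symmetric using (fwd)
open import Relation.Nullary using (¬_; yes; no; does; contradiction)
open import Relation.Nullary.Decidable using (dec-true)
open import Relation.Unary using (Pred; Decidable)
open import Relation.Unary.Properties using (∁?)

private
  variable
    ℓ : Level
    n : ℕ

next-irrefl : ∀ {k} (i : Fin (suc (suc k))) → next i ≢ i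
next-irrefl {k} i eq with suc k ≟ℕ toℕ i
next-irrefl zero    eq | yes k+1≡0 = 1+n≢0 k+1≡0
next-irrefl (suc i) () | yes _
... | no ne = 1+n≢n (trans (cong suc (sym (toℕ-lower₁ i ne))) (cong toℕ eq))

≈-cons : (c : Fin n) {x y : Word n} → x ≈ y → (c ∷ x) ≈ (c ∷ y)
≈-cons c = gmap (c ∷_) step-cons
  where
  step-cons : ∀ {x y} → Step x y → Step (c ∷ x) (c ∷ y)
  step-cons (square u v i)   = square (c ∷ u) v i
  step-cons (braid u v i ne) = braid (c ∷ u) v i ne
  step-cons (comm u v i j a) = comm (c ∷ u) v i j a

commute-past : (c : Fin n) (f r : Word n) → All (λ b → ¬ Adjacent c b) f →
               (c ∷ f ++ r) ≈ (f ++ c ∷ r)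
commute-past c []      r []         = ε
commute-past c (b ∷ f) r (na ∷ nas) =
  fwd (comm [] (f ++ r) c b na) ◅ ≈-cons b (commute-past c f r nas)

sort-by : {P : Pred (Fin n) ℓ} (P? : Decidable P) {x : Word n} →
          AllPairs (λ a b → P a → ¬ P b → ¬ Adjacent a b) x →
          x ≈ (filter (∁? P?) x ++ filter P? x)
sort-by P? [] = ε
sort-by P? {c ∷ x} (c-ok ∷ ok) with P? c
... | no  _  = ≈-cons c (sort-by P? ok)
... | yes pc = ≈-cons c (sort-by P? ok) ◅◅
               commute-past c (filter (∁? P?) x) (filter P? x) (All.tabulate commutes)
  where
  commutes : ∀ {b} → b ∈L filter (∁? P?) x → ¬ Adjacent c b
  commutes b∈ with ∈-filter⁻ (∁? P?) b∈
  ... | b∈x , ¬pb = All.lookup c-ok b∈x pc ¬pb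

data Before (a b : Fin n) : Word n → Set where
  here  : ∀ {x}   → b ∈L x → Before a b (a ∷ x)
  there : ∀ {c x} → Before a b x → Before a b (c ∷ x)

Before⇒split : ∀ {a b : Fin n} {x} → Before a b x →
               ∃[ α ] ∃[ β ] (x ≡ α ++ a ∷ β × b ∈L β)
Before⇒split (here {x} b∈) = [] , x , refl , b∈
Before⇒split (there {c} p) with Before⇒split p
... | α , β , refl , b∈ = c ∷ α , β , refl , b∈

before? : (a b : Fin n) → Decidable (Before a b)
before? a b [] = no λ ()
before? a b (c ∷ x) with c ≟ a | any? (b ≟_) x | before? a b x
... | _        | _      | yes p  = yes (there p)
... | yes refl | yes b∈ | no _   = yes (here b∈)
... | yes refl | no b∉  | no ¬p  = no λ { (here b∈) → b∉ b∈ ; (there p) → ¬p p }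
... | no c≢a   | _      | no ¬p  = no λ { (here _) → c≢a refl ; (there p) → ¬p p }

Before-∈ : ∀ {a b : Fin n} {x} → Before a b x → b ∈L x
Before-∈ (here b∈) = there b∈
Before-∈ (there p) = there (Before-∈ p)

Before-later : ∀ {a b c : Fin n} {x} → Before a b (c ∷ x) → b ∈L x
Before-later (here b∈) = b∈
Before-later (there p) = Before-∈ p

Before-++ : ∀ {a b : Fin n} {α β} → a ∈L α → b ∈L β → Before a b (α ++ β)
Before-++ {α = _ ∷ α} (here refl) b∈ = here (∈-++⁺ʳ α b∈)
Before-++ (there a∈) b∈ = there (Before-++ a∈ b∈)

Before-filter : ∀ {P : Pred (Fin n) ℓ} (P? : Decidable P) {a b x} →
                P a → P b → Before a b x → Before a b (filter P? x)
Before-filter P? {a} pa pb (here b∈) with P? a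
... | yes _  = here (∈-filter⁺ P? b∈ pb)
... | no ¬pa = contradiction pa ¬pa
Before-filter P? pa pb (there {c} p) with P? c
... | yes _ = there (Before-filter P? pa pb p)
... | no  _ = Before-filter P? pa pb p

Before-asym : ∀ {a b : Fin n} {x} → Unique x → Before a b x → ¬ Before b a x
Before-asym (c-new ∷ _) (here _)  q        = All.lookup c-new (Before-later q) refl
Before-asym (c-new ∷ _) (there p) (here _) = All.lookup c-new (Before-∈ p) refl
Before-asym (_ ∷ u)     (there p) (there q) = Before-asym u p q

Before-total : ∀ {a b : Fin n} {x} → a ≢ b → a ∈L x → b ∈L x →
               Before a b x ⊎ Before b a x
Before-total a≢b (here refl) (here refl) = contradiction refl a≢b
Before-total _   (here refl) (there b∈)  = inj₁ (here b∈)
Before-total _   (there a∈)  (here refl) = inj₂ (here a∈)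
Before-total a≢b (there a∈)  (there b∈)  = ⊎-map there there (Before-total a≢b a∈ b∈)

AllPairs-Before : ∀ {R : Fin n → Fin n → Set ℓ} {x} →
                  (∀ {a b} → Before a b x → R a b) → AllPairs R x
AllPairs-Before {x = []}    h = []
AllPairs-Before {x = c ∷ x} h = All.tabulate (h ∘ here) ∷ AllPairs-Before (h ∘ there)

first-letter : ∀ {k} (x : Word (suc (suc k))) → (∀ j → j ∈L x) → ∃[ c ] Before c (next c) x
first-letter []      complete = contradiction (complete zero) λ ()
first-letter (c ∷ y) complete with complete (next c)
... | here nc≡c = contradiction nc≡c (next-irrefl c)
... | there nc∈ = c , here nc∈

last-letter : ∀ {k} (x : Word (suc (suc k))) → (∀ j → j ∈L x) → ∃[ e ] Before (next e) e x
last-letter x complete with initLast x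
... | []     = contradiction (complete zero) λ ()
... | α ∷ʳ′ e with ∈-++⁻ α (complete (next e))
...   | inj₁ ne∈         = e , Before-++ ne∈ (here refl)
...   | inj₂ (here ne≡e) = contradiction ne≡e (next-irrefl e)

occ-pos : ∀ {i : Fin n} {x} → i ∈L x → 1 ≤ occ i x
occ-pos {i = i} {c ∷ x} i∈ with c ≟ i | i∈
... | yes _  | _          = s≤s z≤n
... | no c≢i | here i≡c   = contradiction (sym i≡c) c≢i
... | no _   | there i∈x  = occ-pos i∈x

occ-pos⁻ : ∀ (i : Fin n) x → 1 ≤ occ i x → i ∈L x
occ-pos⁻ i (c ∷ x) o with c ≟ i
... | yes c≡i = here (sym c≡i)
... | no  _   = there (occ-pos⁻ i x o)

occ-tail : ∀ (i c : Fin n) x → occ i x ≤ occ i (c ∷ x)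
occ-tail i c x with c ≟ i
... | yes _ = n≤1+n _
... | no  _ = ≤-refl

occ≤1⇒Unique : ∀ (x : Word n) → (∀ i → occ i x ≤ 1) → Unique x
occ≤1⇒Unique []      _  = []
occ≤1⇒Unique (c ∷ x) le =
  All.tabulate c-new ∷ occ≤1⇒Unique x (λ i → ≤-trans (occ-tail i c x) (le i))
  where
  c-new : ∀ {b} → b ∈L x → c ≢ b
  c-new b∈ refl with c ≟ c | le c
  ... | yes _  | s≤s occ≤0 = 1+n≰n (≤-trans (occ-pos b∈) occ≤0)
  ... | no c≢c | _         = c≢c refl

subset : {P : Pred (Fin n) ℓ} → Decidable P → Subset n
subset P? = tabulate (does ∘ P?)

∈-subset : {P : Pred (Fin n) ℓ} (P? : Decidable P) (j : Fin n) → j ∈S subset P? ⇔ P j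
∈-subset {P = P} P? j = mk⇔ to from
  where
  to : j ∈S subset P? → P j
  to j∈ with P? j | trans (sym (lookup∘tabulate (does ∘ P?) j)) ([]=⇒lookup j∈)
  ... | yes pj | _ = pj
  from : P j → j ∈S subset P?
  from pj = lookup⇒[]= j _ (trans (lookup∘tabulate (does ∘ P?) j) (dec-true (P? j) pj))

subword-letters : ∀ {P : Pred (Fin n) ℓ} (P? : Decidable P) (S : Subset n) {x} →
                  Unique x → (∀ j → j ∈L x) → (∀ j → j ∈S S ⇔ P j) →
                  Unique (filter P? x) × (∀ j → j ∈S S ⇔ j ∈L filter P? x)
subword-letters P? S {x} unique complete S⇔P =
  filter⁺ P? unique ,
  λ j → mk⇔ (λ j∈S → ∈-filter⁺ P? (complete j) (Equivalence.to (S⇔P j) j∈S))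
            (λ j∈ → Equivalence.from (S⇔P j) (proj₂ (∈-filter⁻ P? {xs = x} j∈)))

module CoxeterWord {k : ℕ} (x : Word (suc (suc k))) (unique : Unique x)
                   (complete : ∀ j → j ∈L x) where

  J : Subset (suc (suc k))
  J = subset (λ j → before? (next j) j x)

  ∈J⇔ : ∀ j → j ∈S J ⇔ Before (next j) j x
  ∈J⇔ = ∈-subset (λ j → before? (next j) j x)

  ∈J : ∀ {j} → j ∈S J → Before (next j) j x
  ∈J {j} = Equivalence.to (∈J⇔ j)

  ∉J : ∀ {j} → ¬ j ∈S J → Before j (next j) x
  ∉J {j} j∉J with Before-total (λ j≡nj → next-irrefl j (sym j≡nj)) (complete j) (complete (next j))
  ... | inj₁ p = p
  ... | inj₂ p = contradiction (Equivalence.from (∈J⇔ j) p) j∉J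

  d u : Word (suc (suc k))
  d = filter (_∈? J) x
  u = filter (∁? (_∈? J)) x

  -- If a ∈ J occurs before b ∉ J then a, b commute: b = a+1 would place
  -- s_{a+1} both after and before s_a, and a = b+1 would force b ∈ J.
  sorted : x ≈ (u ++ d)
  sorted = sort-by (_∈? J) (AllPairs-Before commutes)
    where
    commutes : ∀ {a b} → Before a b x → a ∈S J → ¬ b ∈S J → ¬ Adjacent a b
    commutes a<b a∈J _   (inj₁ refl) = Before-asym unique a<b (∈J a∈J)
    commutes a<b _   b∉J (inj₂ refl) = b∉J (Equivalence.from (∈J⇔ _) a<b)

  isD : IsD J d
  isD with subword-letters (_∈? J) J unique complete (λ j → mk⇔ (λ p → p) (λ p → p))
  ... | d-unique , d-letters = d-unique , d-letters , order
    where
    order : ∀ j → j ∈S J → next j ∈S J → ∃[ a ] ∃[ b ] (d ≡ a ++ next j ∷ b × j ∈L b)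
    order j j∈J nj∈J = Before⇒split (Before-filter (_∈? J) nj∈J j∈J (∈J j∈J))

  isU : IsU (∁ J) u
  isU with subword-letters (∁? (_∈? J)) (∁ J) unique complete (λ j → mk⇔ x∈∁p⇒x∉p x∉p⇒x∈∁p)
  ... | u-unique , u-letters = u-unique , u-letters , order
    where
    order : ∀ j → j ∈S ∁ J → next j ∈S ∁ J → ∃[ a ] ∃[ b ] (u ≡ a ++ j ∷ b × next j ∈L b)
    order j j∉J nj∉J = Before⇒split
      (Before-filter (∁? (_∈? J)) (x∈∁p⇒x∉p j∉J) (x∈∁p⇒x∉p nj∉J) (∉J (x∈∁p⇒x∉p j∉J)))

  proper : Proper J
  proper with first-letter x complete
  ... | c , c<nc = c , λ c∈J → Before-asym unique c<nc (∈J c∈J)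

  nonempty : ∃[ j ] (j ∈S J)
  nonempty with last-letter x complete
  ... | e , ne<e = e , Equivalence.from (∈J⇔ e) ne<e

  ribbon : ConnectedRibbon x
  ribbon = J , nonempty , proper , u , d , isU , isD , sorted

ribbon-resp : ∀ {x w : Word n} → x ≈ w → ConnectedRibbon x → ConnectedRibbon w
ribbon-resp x≈w (J , nonempty , proper , u , d , isU , isD , x≈ud) =
  J , nonempty , proper , u , d , isU , isD , (symmetric Step x≈w ◅◅ x≈ud)

lemma8 : ∀ (n m : ℕ) → 0 < m → m < n → (w : Word n) →
    InA n m w → EachGenOnce w → ConnectedRibbon w
lemma8 zero          m       _  ()       w _ _
lemma8 (suc zero)    zero    () _        w _ _
lemma8 (suc zero)    (suc m) _  (s≤s ()) w _ _
lemma8 (suc (suc k)) m       _  _        w _ (x , x≈w , _ , once) =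
  ribbon-resp x≈w (CoxeterWord.ribbon x unique complete)
  where
  unique : Unique x
  unique = occ≤1⇒Unique x (λ i → ≤-reflexive (once i))
  complete : ∀ j → j ∈L x
  complete j = occ-pos⁻ j x (≤-reflexive (sym (once j)))
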